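{- Given an initial diagonal of $n$ nodes, the transformation DL-Partitioning (described in the context) transforms it into a horizontal straight line of $n$ nodes in $O(n\sqrt{n})$ line moves.
   Context: Nodes occupy distinct cells of the two-dimensional square grid, cells addressed by integer coordinates $(x,y)$. A shape is a finite set of nodes. A line is a set of one or more nodes occupying consecutive cells of one row or column. A line move (one step): a line of $k\ge1$ nodes occupying $(x_1,y),\dots,(x_1+k-1,y)$ may move right by one cell if $(x_1+k,y)$ is empty, or left by one cell if $(x_1-1,y)$ is empty; vertical lines move up/down analogously; all nodes move simultaneously. Connectivity need not be preserved during the transformation. A diagonal of order $n$ is a shape with nodes at $(x+j,y+j)$, $j=0,\dots,n-1$. DL-Partitioning: divide the diagonal into $\lceil\sqrt n\rceil$ consecutive diagonal segments of length $\lfloor\sqrt n\rfloor$ (apart possibly from one shorter one). Phase 1: in each segment, move each node individually (horizontally) to the leftmost column of that segment, forming a vertical line segment. Phase 2: push each vertical line segment down to the bottommost row $y$ of the diagonal. Phase 3: turn each segment into row $y$, so that all nodes form a horizontal line in row $y$. -}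

module Defs where

open import Data.Nat using (ℕ; zero; suc; _+_; _*_; _∸_; _≤ᵇ_; _⊓_)
open import Data.Nat.DivMod using (_/_; _%_)
open import Data.Integer using (ℤ; +_; -[1+_]) renaming (_+_ to _+ℤ_)
import Data.Integer.Properties as ℤP
open import Data.Bool using (Bool; true; false; if_then_else_; _∧_; not)
open import Data.List using (List; []; _∷_; map; concatMap; upTo; _++_)
open import Data.List.Membership.Propositional using (_∈_)
open import Data.Maybe using (Maybe; just; nothing)
open import Data.Product using (_×_; _,_; ∃)
open import Data.Product.Properties using (≡-dec)
open import Relation.Nullary using (does)
open import Function.Bundles using (_⇔_)
import Data.List.Membership.DecPropositional as DecMem

Cell : Set
Cell = ℤ × ℤ

Shape : Set
Shape = List Cell     -- a finite set of nodes (list of occupied cells)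

private
  module M = DecMem (≡-dec ℤP._≟_ ℤP._≟_)

allᵇ : {A : Set} → (A → Bool) → List A → Bool
allᵇ p []       = true
allᵇ p (a ∷ as) = p a ∧ allᵇ p as

_∈ᵇ_ : Cell → Shape → Bool
c ∈ᵇ S = does (c M.∈? S)

data Orientation : Set where
  horizontal vertical : Orientation

-- forward = +1 along the axis (right / up), backward = -1 (left / down)
data Dir : Set where
  forward backward : Dir

shift : Orientation → Cell → ℤ → Cell
shift horizontal (a , b) d = (a +ℤ d , b)
shift vertical   (a , b) d = (a , b +ℤ d)

-- A line move: the line consists of the cells start, start+1, ..., start+(len-1)
-- along the orientation axis; it moves one cell in direction dir.
record LineMove : Set where
  constructor lineMove
  field
    start  : Cell
    orient : Orientation
    len    : ℕ
    dir    : Dir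

open LineMove public

lineCells : LineMove → List Cell
lineCells m = map (λ t → shift (orient m) (start m) (+ t)) (upTo (len m))

targetCell : LineMove → Cell
targetCell m with dir m
... | forward  = shift (orient m) (start m) (+ len m)
... | backward = shift (orient m) (start m) -[1+ 0 ]

delta : Dir → ℤ
delta forward  = + 1
delta backward = -[1+ 0 ]

positive : ℕ → Bool
positive zero    = false
positive (suc _) = true

applyMove : LineMove → Shape → Maybe Shape
applyMove m S =
  if positive (len m) ∧ allᵇ (λ c → c ∈ᵇ S) (lineCells m) ∧ not (targetCell m ∈ᵇ S)
  then just (map (λ c → if c ∈ᵇ lineCells m then shift (orient m) c (delta (dir m)) else c) S)
  else nothing

run : List LineMove → Shape → Maybe Shape
run []       S = just S
run (m ∷ ms) S with applyMove m S
... | nothing = nothing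
... | just S′ = run ms S′

diagonal : ℤ → ℤ → ℕ → Shape
diagonal x y n = map (λ j → (x +ℤ + j , y +ℤ + j)) (upTo n)

horizontalLineAt : ℤ → ℤ → ℕ → Shape
horizontalLineAt a b n = map (λ j → (a +ℤ + j , b)) (upTo n)

IsHorizontalLine : Shape → ℕ → Set
IsHorizontalLine S n = ∃ λ a → ∃ λ b → ∀ (c : Cell) → (c ∈ S) ⇔ (c ∈ horizontalLineAt a b n)

isqrtFrom : ℕ → ℕ → ℕ
isqrtFrom n zero    = zero
isqrtFrom n (suc k) = if suc k * suc k ≤ᵇ n then suc k else isqrtFrom n k

isqrt : ℕ → ℕ
isqrt n = isqrtFrom n n

-- DL-Partitioning
-- s = ⌊√n⌋ (segment length; written suc (s ∸ 1) to have a NonZero divisor,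
-- which equals ⌊√n⌋ for every n ≥ 1; for n = 0 no moves are generated).
-- Node j (0 ≤ j < n) sits at (x+j, y+j) and belongs to segment j / s,
-- at position j % s inside it.

segLen : ℕ → ℕ
segLen n = suc (isqrt n ∸ 1)

numSegs : ℕ → ℕ
numSegs n = (n + segLen n ∸ 1) / segLen n

segSize : ℕ → ℕ → ℕ
segSize n i = segLen n ⊓ (n ∸ i * segLen n)

-- Phase 1: node j moves left (j % s) times, one cell at a time, to the
-- leftmost column x + (j / s) s of its segment.
phase1 : ℤ → ℤ → ℕ → List LineMove
phase1 x y n =
  concatMap (λ j → map (λ t → lineMove (x +ℤ + (j ∸ t) , y +ℤ + j) horizontal 1 backward)
                       (upTo (j % segLen n)))
            (upTo n)

-- Phase 2: the vertical segment i (column x+is, rows y+is .. y+is+size-1)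
-- is pushed down, as a line, i·s times, to bottom row y.
phase2 : ℤ → ℤ → ℕ → List LineMove
phase2 x y n =
  concatMap (λ i → map (λ t → lineMove (x +ℤ + (i * segLen n) , y +ℤ + (i * segLen n ∸ t))
                                       vertical (segSize n i) backward)
                       (upTo (i * segLen n)))
            (upTo (numSegs n))

-- Phase 3: in segment i (column c = x+is), the node in row y+r moves right r
-- cells and then down r cells, ending at (c+r, y); done for r = 0,1,...
phase3 : ℤ → ℤ → ℕ → List LineMove
phase3 x y n =
  concatMap (λ i →
    concatMap (λ r →
        map (λ t → lineMove (x +ℤ + (i * segLen n + t) , y +ℤ + r) horizontal 1 forward) (upTo r)
     ++ map (λ t → lineMove (x +ℤ + (i * segLen n + r) , y +ℤ + (r ∸ t)) vertical 1 backward) (upTo r))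
      (upTo (segSize n i)))
    (upTo (numSegs n))

dlPartitioning : ℤ → ℤ → ℕ → List LineMove
dlPartitioning x y n = phase1 x y n ++ phase2 x y n ++ phase3 x y n

module Submission where

-- A shape is described by an indexed family of node positions,
-- given as natural offsets from the corner (x, y) of the diagonal.  Each
-- phase is then described by an explicit intermediate state, a three-way
-- selection (select) between nodes already moved, the node or segment in
-- motion, and nodes still waiting; each individual move is checked with the
-- general lemma, and run-concatMap / run-map chain the moves.  The phases
-- lead diagonal → vertical segments → segments at the bottom row → line.
--
-- With s = ⌊√n⌋ and N = ⌈n/s⌉ ≤ 4s segments, Phase 1 uses at most
-- n·s moves, Phase 2 at most N·N·s and Phase 3 at most N·s·2s, in total at
-- most 13·n·s; squaring and s² ≤ n give (#moves)² ≤ 13²·n³.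

open import Defs
open import Data.Nat using (ℕ; zero; suc; _+_; _*_; _∸_; _<_; _≤_; _≤ᵇ_; z≤n; s≤s; pred; _≟_; _≤?_)
open import Data.Nat.Properties
open import Data.Nat.DivMod
open import Data.Nat.Divisibility using (divides)
open import Data.Nat.Tactic.RingSolver using (solve-∀)
open import Data.Integer as ℤ using (ℤ; +_; -[1+_])
import Data.Integer.Properties as ℤP
open import Algebra.Bundles using (AbelianGroup)
open import Algebra.Properties.Group (AbelianGroup.group ℤP.+-0-abelianGroup) using (∙-cancelˡ)
open import Data.List using (List; []; _∷_; length; map; concatMap; upTo; applyUpTo; _++_)
open import Data.List.Properties using (map-applyUpTo; map-upTo; length-++; length-map; length-upTo)
open import Data.List.Membership.Propositional using (_∈_; _∉_)
open import Data.List.Membership.Propositional.Properties using (∈-applyUpTo⁺; ∈-applyUpTo⁻)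
import Data.List.Membership.DecPropositional as DecMembership
open import Data.Maybe using (just)
open import Data.Product using (_×_; _,_; ∃; proj₁; proj₂)
open import Data.Product.Properties using (≡-dec)
open import Data.Sum using (_⊎_; inj₁; inj₂)
open import Data.Bool using (Bool; true; false; if_then_else_; T)
open import Data.Unit using (⊤; tt)
open import Data.Empty using (⊥-elim)
open import Relation.Nullary using (yes; no)
open import Relation.Nullary.Decidable using (dec-true; dec-false)
open import Relation.Binary.Definitions using (tri<; tri≈; tri>)
open import Relation.Binary.PropositionalEquality
open import Function using (id; _∘_)
open import Function.Bundles using (mk⇔)

run-++ : ∀ ms ms′ S S′ → run ms S ≡ just S′ → run (ms ++ ms′) S ≡ run ms′ S′
run-++ []       ms′ S S′ refl = refl
run-++ (m ∷ ms) ms′ S S′ h with applyMove m S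
... | just S₁ = run-++ ms ms′ S₁ S′ h

run-concatMap : (F : ℕ → List LineMove) (f : ℕ → ℕ) (st : ℕ → Shape) (N : ℕ) →
  (∀ k → k < N → run (F (f k)) (st k) ≡ just (st (suc k))) →
  run (concatMap F (applyUpTo f N)) (st 0) ≡ just (st N)
run-concatMap F f st zero    h = refl
run-concatMap F f st (suc N) h =
  trans (run-++ (F (f 0)) _ (st 0) (st 1) (h 0 (s≤s z≤n)))
        (run-concatMap F (f ∘ suc) (st ∘ suc) N (λ k k<N → h (suc k) (s≤s k<N)))

run-map : (G : ℕ → LineMove) (f : ℕ → ℕ) (st : ℕ → Shape) (N : ℕ) →
  (∀ k → k < N → applyMove (G (f k)) (st k) ≡ just (st (suc k))) →
  run (map G (applyUpTo f N)) (st 0) ≡ just (st N)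
run-map G f st zero    h = refl
run-map G f st (suc N) h with applyMove (G (f 0)) (st 0) | h 0 (s≤s z≤n)
... | just _ | refl = run-map G (f ∘ suc) (st ∘ suc) N (λ k k<N → h (suc k) (s≤s k<N))

applyUpTo-cong : ∀ {A : Set} (f g : ℕ → A) N → (∀ k → k < N → f k ≡ g k) →
  applyUpTo f N ≡ applyUpTo g N
applyUpTo-cong f g zero    h = refl
applyUpTo-cong f g (suc N) h =
  cong₂ _∷_ (h 0 (s≤s z≤n)) (applyUpTo-cong (f ∘ suc) (g ∘ suc) N (λ k k<N → h (suc k) (s≤s k<N)))

allᵇ-applyUpTo : ∀ {A : Set} (p : A → Bool) (f : ℕ → A) N →
  (∀ k → k < N → p (f k) ≡ true) → allᵇ p (applyUpTo f N) ≡ true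
allᵇ-applyUpTo p f zero    h = refl
allᵇ-applyUpTo p f (suc N) h rewrite h 0 (s≤s z≤n) =
  allᵇ-applyUpTo p (f ∘ suc) N (λ k k<N → h (suc k) (s≤s k<N))

private
  module Mem = DecMembership (≡-dec ℤP._≟_ ℤP._≟_)

∈ᵇ-true : ∀ {c L} → c ∈ L → c ∈ᵇ L ≡ true
∈ᵇ-true {c} {L} = dec-true (c Mem.∈? L)

∈ᵇ-false : ∀ {c L} → c ∉ L → c ∈ᵇ L ≡ false
∈ᵇ-false {c} {L} = dec-false (c Mem.∈? L)

lineCell : LineMove → ℕ → Cell
lineCell m u = shift (orient m) (start m) (+ u)

lineCells-applyUpTo : ∀ m → lineCells m ≡ applyUpTo (lineCell m) (len m)
lineCells-applyUpTo m = map-upTo (lineCell m) (len m)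

Moved : LineMove → (ℕ → Cell) → (ℕ → Cell) → ℕ → Set
Moved m P P′ j =
    ((∃ λ u → u < len m × P j ≡ lineCell m u) × P′ j ≡ shift (orient m) (P j) (delta (dir m)))
  ⊎ ((∀ u → u < len m → P j ≢ lineCell m u) × P′ j ≡ P j)

moveCell : LineMove → Cell → Cell
moveCell m c = if c ∈ᵇ lineCells m then shift (orient m) c (delta (dir m)) else c

moveCell-on : ∀ m {c} → c ∈ lineCells m → moveCell m c ≡ shift (orient m) c (delta (dir m))
moveCell-on m c∈ rewrite ∈ᵇ-true c∈ = refl

moveCell-off : ∀ m {c} → c ∉ lineCells m → moveCell m c ≡ c
moveCell-off m c∉ rewrite ∈ᵇ-false c∉ = refl

applyMove-valid : (m : LineMove) (S : Shape) → positive (len m) ≡ true →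
  allᵇ (λ c → c ∈ᵇ S) (lineCells m) ≡ true → targetCell m ∈ᵇ S ≡ false →
  applyMove m S ≡ just (map (moveCell m) S)
applyMove-valid m S nonempty occupied free rewrite nonempty | occupied | free = refl

applyMove-indexed : (m : LineMove) (P P′ : ℕ → Cell) (n : ℕ) →
  positive (len m) ≡ true →
  (∀ u → u < len m → ∃ λ j → j < n × P j ≡ lineCell m u) →
  (∀ j → j < n → P j ≢ targetCell m) →
  (∀ j → j < n → Moved m P P′ j) →
  applyMove m (applyUpTo P n) ≡ just (applyUpTo P′ n)
applyMove-indexed m P P′ n nonempty occupied free moved =
  trans (applyMove-valid m S nonempty lineOccupied targetFree)
        (cong just (trans (map-applyUpTo P (moveCell m) n) (applyUpTo-cong (moveCell m ∘ P) P′ n movedCell)))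
  where
  S = applyUpTo P n
  lineOccupied : allᵇ (λ c → c ∈ᵇ S) (lineCells m) ≡ true
  lineOccupied rewrite lineCells-applyUpTo m =
    allᵇ-applyUpTo _ (lineCell m) (len m) λ u u<len →
      let (j , j<n , e) = occupied u u<len in ∈ᵇ-true (subst (_∈ S) e (∈-applyUpTo⁺ P j<n))
  targetFree : targetCell m ∈ᵇ S ≡ false
  targetFree = ∈ᵇ-false λ mem → let (j , j<n , e) = ∈-applyUpTo⁻ P mem in free j j<n (sym e)
  movedCell : ∀ j → j < n → moveCell m (P j) ≡ P′ j
  movedCell j j<n with moved j j<n
  ... | inj₁ ((u , u<len , onLine) , e) = trans (moveCell-on m onLineCells) (sym e)
    where onLineCells : P j ∈ lineCells m
          onLineCells rewrite lineCells-applyUpTo m = subst (_∈ _) (sym onLine) (∈-applyUpTo⁺ (lineCell m) u<len)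
  ... | inj₂ (offLine , e) = trans (moveCell-off m offLineCells) (sym e)
    where offLineCells : P j ∉ lineCells m
          offLineCells mem rewrite lineCells-applyUpTo m =
            let (u , u<len , e′) = ∈-applyUpTo⁻ (lineCell m) mem in offLine u u<len e′

-- Offsets: all nodes stay weakly above and to the right of the corner (x, y)
-- of the diagonal, so positions can be recorded as natural offsets.

Offset : Set
Offset = ℕ × ℕ

at : ℤ → ℤ → Offset → Cell
at x y (a , b) = (x ℤ.+ + a , y ℤ.+ + b)

+-offset : ∀ x a u → x ℤ.+ + a ℤ.+ + u ≡ x ℤ.+ + (a + u)
+-offset x a u = trans (ℤP.+-assoc x (+ a) (+ u)) (cong (λ z → x ℤ.+ z) (sym (ℤP.pos-+ a u)))

at-injective : ∀ x y {c c′} → at x y c ≡ at x y c′ → c ≡ c′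
at-injective x y {a , b} {a′ , b′} e =
  cong₂ _,_ (ℤP.+-injective (∙-cancelˡ x (+ a) (+ a′) (cong proj₁ e)))
            (ℤP.+-injective (∙-cancelˡ y (+ b) (+ b′) (cong proj₂ e)))

-- The u-th cell of a line starting at c, one step in a direction, and the
-- condition that a backward step does not leave the quadrant.
along : Orientation → Offset → ℕ → Offset
along horizontal (a , b) u = (a + u , b)
along vertical   (a , b) u = (a , b + u)

step : Orientation → Dir → Offset → Offset
step horizontal forward  (a , b) = (suc a , b)
step horizontal backward (a , b) = (pred a , b)
step vertical   forward  (a , b) = (a , suc b)
step vertical   backward (a , b) = (a , pred b)

CanStep : Orientation → Dir → Offset → Set
CanStep o          forward  c       = ⊤
CanStep horizontal backward (a , b) = 1 ≤ a
CanStep vertical   backward (a , b) = 1 ≤ b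

target : Orientation → Dir → Offset → ℕ → Offset
target o forward  c k = along o c k
target o backward c k = step o backward c

target-single : ∀ o d c → target o d c 1 ≡ step o d c
target-single horizontal forward  (a , b) = cong (_, b) (+-comm a 1)
target-single vertical   forward  (a , b) = cong (a ,_) (+-comm b 1)
target-single o          backward c       = refl

canStep-along : ∀ o d c u → CanStep o d c → CanStep o d (along o c u)
canStep-along o          forward  c       u ok = tt
canStep-along horizontal backward (a , b) u ok = ≤-trans ok (m≤m+n a u)
canStep-along vertical   backward (a , b) u ok = ≤-trans ok (m≤m+n b u)

at-along : ∀ x y o c u → shift o (at x y c) (+ u) ≡ at x y (along o c u)
at-along x y horizontal (a , b) u = cong (_, _) (+-offset x a u)
at-along x y vertical   (a , b) u = cong (_ ,_) (+-offset y b u)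

at-step : ∀ x y o d c → CanStep o d c → shift o (at x y c) (delta d) ≡ at x y (step o d c)
at-step x y horizontal forward  (a , b)     _ = cong (_, _) (trans (+-offset x a 1) (cong (λ z → x ℤ.+ + z) (+-comm a 1)))
at-step x y vertical   forward  (a , b)     _ = cong (_ ,_) (trans (+-offset y b 1) (cong (λ z → y ℤ.+ + z) (+-comm b 1)))
at-step x y horizontal backward (suc a , b) _ = cong (_, _) (ℤP.+-assoc x (+ suc a) -[1+ 0 ])
at-step x y vertical   backward (a , suc b) _ = cong (_ ,_) (ℤP.+-assoc y (+ suc b) -[1+ 0 ])

at-target : ∀ x y o d c k → CanStep o d c → targetCell (lineMove (at x y c) o k d) ≡ at x y (target o d c k)
at-target x y o forward  c k _  = at-along x y o c k
at-target x y o backward c k ok = at-step x y o backward c ok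

nodes : ℤ → ℤ → ℕ → (ℕ → Offset) → Shape
nodes x y n Q = applyUpTo (at x y ∘ Q) n

nodes-cong : ∀ x y n {Q Q′ : ℕ → Offset} → (∀ j → j < n → Q j ≡ Q′ j) → nodes x y n Q ≡ nodes x y n Q′
nodes-cong x y n {Q} {Q′} Q≡Q′ =
  applyUpTo-cong (at x y ∘ Q) (at x y ∘ Q′) n (λ j j<n → cong (at x y) (Q≡Q′ j j<n))

MovedBy : Orientation → Dir → Offset → ℕ → (ℕ → Offset) → (ℕ → Offset) → ℕ → Set
MovedBy o d c k Q Q′ j =
    ((∃ λ u → u < k × Q j ≡ along o c u) × Q′ j ≡ step o d (Q j))
  ⊎ ((∀ u → u < k → Q j ≢ along o c u) × Q′ j ≡ Q j)

applyMove-offsets : ∀ x y o d c k (Q Q′ : ℕ → Offset) n →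
  CanStep o d c → 1 ≤ k →
  (∀ u → u < k → ∃ λ j → j < n × Q j ≡ along o c u) →
  (∀ j → j < n → Q j ≢ target o d c k) →
  (∀ j → j < n → MovedBy o d c k Q Q′ j) →
  applyMove (lineMove (at x y c) o k d) (nodes x y n Q) ≡ just (nodes x y n Q′)
applyMove-offsets x y o d c (suc k) Q Q′ n ok _ occupied free moved =
  applyMove-indexed (lineMove (at x y c) o (suc k) d) (at x y ∘ Q) (at x y ∘ Q′) n refl
    (λ u u<k → let (j , j<n , e) = occupied u u<k in j , j<n , onLine e)
    (λ j j<n e → free j j<n (at-injective x y (trans e (at-target x y o d c (suc k) ok))))
    moved′
  where
  onLine : ∀ {j u} → Q j ≡ along o c u → at x y (Q j) ≡ lineCell (lineMove (at x y c) o (suc k) d) u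
  onLine {j} {u} e = trans (cong (at x y) e) (sym (at-along x y o c u))
  moved′ : ∀ j → j < n → Moved (lineMove (at x y c) o (suc k) d) (at x y ∘ Q) (at x y ∘ Q′) j
  moved′ j j<n with moved j j<n
  ... | inj₁ ((u , u<k , e) , e′) =
        inj₁ ((u , u<k , onLine e) ,
              trans (cong (at x y) e′) (sym (at-step x y o d (Q j) (subst (CanStep o d) (sym e) (canStep-along o d c u ok)))))
  ... | inj₂ (off , e′) =
        inj₂ ((λ u u<k e → off u u<k (at-injective x y (trans e (at-along x y o c u)))) , cong (at x y) e′)

applyMove-node : ∀ x y o d c (Q Q′ : ℕ → Offset) n K → K < n → Q K ≡ c → CanStep o d c →
  (∀ j → j < n → j ≢ K → Q j ≢ c) →
  (∀ j → j < n → Q j ≢ step o d c) →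
  Q′ K ≡ step o d c → (∀ j → j ≢ K → Q′ j ≡ Q j) →
  applyMove (lineMove (at x y c) o 1 d) (nodes x y n Q) ≡ just (nodes x y n Q′)
applyMove-node x y o d c Q Q′ n K K<n QK≡c ok distinct free movedK stay =
  applyMove-offsets x y o d c 1 Q Q′ n ok (s≤s z≤n)
    (λ { zero _ → K , K<n , trans QK≡c start≡ ; (suc u) (s≤s ()) })
    (λ j j<n e → free j j<n (trans e (target-single o d c)))
    moved
  where
  start≡ : c ≡ along o c 0
  start≡ = sym (along-zero o c)
    where along-zero : ∀ o c → along o c 0 ≡ c
          along-zero horizontal (a , b) = cong (_, b) (+-identityʳ a)
          along-zero vertical   (a , b) = cong (a ,_) (+-identityʳ b)
  moved : ∀ j → j < n → MovedBy o d c 1 Q Q′ j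
  moved j j<n with j ≟ K
  ... | yes refl = inj₁ ((0 , s≤s z≤n , trans QK≡c start≡) , trans movedK (cong (step o d) (sym QK≡c)))
  ... | no j≢K  =
    inj₂ ((λ { zero _ e → distinct j j<n j≢K (trans e (sym start≡)) ; (suc u) (s≤s ()) _ }) , stay j j≢K)

-- It is opaque: it is only ever used through the three lemmas below, and
-- keeping it from unfolding lets Agda infer their implicit arguments.
opaque
  select : {A : Set} → ℕ → ℕ → A → A → A → A
  select j k a b c with <-cmp j k
  ... | tri< _ _ _ = a
  ... | tri≈ _ _ _ = b
  ... | tri> _ _ _ = c

  select-< : ∀ {A : Set} {j k} {a b c : A} → j < k → select j k a b c ≡ a
  select-< {j = j} {k} j<k with <-cmp j k
  ... | tri< _ _ _   = refl
  ... | tri≈ j≮k _ _ = ⊥-elim (j≮k j<k)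
  ... | tri> j≮k _ _ = ⊥-elim (j≮k j<k)

  select-≡ : ∀ {A : Set} {j k} {a b c : A} → j ≡ k → select j k a b c ≡ b
  select-≡ {j = j} {k} j≡k with <-cmp j k
  ... | tri< _ j≢k _ = ⊥-elim (j≢k j≡k)
  ... | tri≈ _ _ _   = refl
  ... | tri> _ j≢k _ = ⊥-elim (j≢k j≡k)

  select-> : ∀ {A : Set} {j k} {a b c : A} → k < j → select j k a b c ≡ c
  select-> {j = j} {k} k<j with <-cmp j k
  ... | tri< _ _ k≮j = ⊥-elim (k≮j k<j)
  ... | tri≈ _ _ k≮j = ⊥-elim (k≮j k<j)
  ... | tri> _ _ _   = refl

select-cases : ∀ {A : Set} j k (a b c : A) →
    (j < k × select j k a b c ≡ a) ⊎ (j ≡ k × select j k a b c ≡ b) ⊎ (k < j × select j k a b c ≡ c)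
select-cases j k a b c with <-cmp j k
... | tri< j<k _ _ = inj₁ (j<k , select-< j<k)
... | tri≈ _ j≡k _ = inj₂ (inj₁ (j≡k , select-≡ j≡k))
... | tri> _ _ k<j = inj₂ (inj₂ (k<j , select-> k<j))

select-≢ : ∀ {A : Set} {j k} {a b c : A} b′ → j ≢ k → select j k a b c ≡ select j k a b′ c
select-≢ {j = j} {k} b′ j≢k with <-cmp j k
... | tri< j<k _ _ = trans (select-< j<k) (sym (select-< j<k))
... | tri≈ _ j≡k _ = ⊥-elim (j≢k j≡k)
... | tri> _ _ k<j = trans (select-> k<j) (sym (select-> k<j))

select-zero : ∀ {A : Set} {J} {a b c : A} → (J ≡ 0 → b ≡ c) → select J 0 a b c ≡ c
select-zero {J = J} b≡c with <-cmp J 0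
... | tri≈ _ J≡0 _ = trans (select-≡ J≡0) (b≡c J≡0)
... | tri> _ _ 0<J = select-> 0<J

select-suc : ∀ {A : Set} {J k} {a b b′ c : A} → (J ≡ k → b ≡ a) → (J ≡ suc k → b′ ≡ c) →
  select J k a b c ≡ select J (suc k) a b′ c
select-suc {J = J} {k} b≡a b′≡c with <-cmp J k
... | tri< J<k _ _ = trans (select-< J<k) (sym (select-< (m<n⇒m<1+n J<k)))
... | tri≈ _ J≡k _ = trans (trans (select-≡ J≡k) (b≡a J≡k)) (sym (select-< (s≤s (≤-reflexive J≡k))))
... | tri> _ _ k<J with m≤n⇒m<n∨m≡n k<J
...   | inj₁ 1+k<J = trans (select-> k<J) (sym (select-> 1+k<J))
...   | inj₂ 1+k≡J = trans (select-> k<J) (sym (trans (select-≡ (sym 1+k≡J)) (b′≡c (sym 1+k≡J))))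

module Segments (s′ : ℕ) where

  s : ℕ
  s = suc s′

  base : ℕ → ℕ
  base j = (j / s) * s

  decompose : ∀ j → j ≡ base j + j % s
  decompose j = trans (m≡m%n+[m/n]*n j s) (+-comm (j % s) (base j))

  %-segment : ∀ i {r} → r < s → (i * s + r) % s ≡ r
  %-segment i {r} r<s = trans (cong (_% s) (+-comm (i * s) r)) (trans ([m+kn]%n≡m%n r i s) (m<n⇒m%n≡m r<s))

  /-segment : ∀ i {r} → r < s → (i * s + r) / s ≡ i
  /-segment i {r} r<s = begin
    (i * s + r) / s    ≡⟨ +-distrib-/-∣ˡ r (divides i refl) ⟩
    i * s / s + r / s  ≡⟨ cong₂ _+_ (m*n/n≡m i s) (m<n⇒m/n≡0 r<s) ⟩
    i + 0              ≡⟨ +-identityʳ i ⟩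
    i                  ∎
    where open ≡-Reasoning

  base-segment : ∀ i {r} → r < s → base (i * s + r) ≡ i * s
  base-segment i r<s = cong (_* s) (/-segment i r<s)

  segment-bounds : ∀ j i → j / s ≡ i → i * s ≤ j × j < suc i * s
  segment-bounds j .(j / s) refl =
      subst (base j ≤_) (sym (decompose j)) (m≤m+n (base j) (j % s))
    , subst (_< suc (j / s) * s) (sym (decompose j))
            (subst (base j + j % s <_) (+-comm (base j) s) (+-monoʳ-< (base j) (m%n<n j s)))

  ∸-base : ∀ j → j ∸ base j ≡ j % s
  ∸-base j = trans (cong (_∸ base j) (decompose j)) (m+n∸m≡n (base j) (j % s))

  base-∸ : ∀ j → j ∸ j % s ≡ base j
  base-∸ j = trans (cong (_∸ j % s) (decompose j)) (m+n∸n≡m (base j) (j % s))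

  base-cancel : ∀ j i → base j ≡ i * s → j / s ≡ i
  base-cancel j i = *-cancelʳ-≡ (j / s) i s

  -- Bases are multiples of s, so no base lies strictly inside a segment.
  base-aligned : ∀ j i u → base j ≡ i * s + u → u < s → u ≡ 0
  base-aligned j i u e u<s = begin
    u                 ≡⟨ sym (%-segment i u<s) ⟩
    (i * s + u) % s   ≡⟨ cong (_% s) (sym e) ⟩
    base j % s        ≡⟨ m*n%n≡0 (j / s) s ⟩
    0                 ∎
    where open ≡-Reasoning

  node-at : ∀ j i r → base j ≡ i * s → j % s ≡ r → j ≡ i * s + r
  node-at j i r e₁ e₂ = trans (decompose j) (cong₂ _+_ e₁ e₂)

isqrtFrom-sq≤ : ∀ n k → isqrtFrom n k * isqrtFrom n k ≤ n
isqrtFrom-sq≤ n zero = z≤n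
isqrtFrom-sq≤ n (suc k) with suc k * suc k ≤ᵇ n in eq
... | true  = ≤ᵇ⇒≤ (suc k * suc k) n (subst T (sym eq) tt)
... | false = isqrtFrom-sq≤ n k

isqrtFrom-maximal : ∀ n k m → m ≤ k → m * m ≤ n → m ≤ isqrtFrom n k
isqrtFrom-maximal n zero    m m≤k _ = m≤k
isqrtFrom-maximal n (suc k) m m≤k m*m≤n with suc k * suc k ≤ᵇ n in eq
... | true  = m≤k
... | false = isqrtFrom-maximal n k m m≤k′ m*m≤n
  where
  m≤k′ : m ≤ k
  m≤k′ with m ≟ suc k
  ... | yes refl = ⊥-elim (subst T eq (≤⇒≤ᵇ m*m≤n))
  ... | no m≢k   = ≤-pred (≤∧≢⇒< m≤k m≢k)

m≤m*m : ∀ m → m ≤ m * m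
m≤m*m zero    = z≤n
m≤m*m (suc m) = m≤m*n (suc m) (suc m)

module SegmentLength (n : ℕ) where

  s : ℕ
  s = segLen n

  isqrt≤ : isqrt n ≤ n
  isqrt≤ = ≤-trans (m≤m*m (isqrt n)) (isqrtFrom-sq≤ n n)

  isqrt≤segLen : isqrt n ≤ s
  isqrt≤segLen with isqrt n
  ... | zero  = z≤n
  ... | suc _ = ≤-refl

  segLen-sq≤ : 1 ≤ n → s * s ≤ n
  segLen-sq≤ 1≤n with isqrt n | isqrtFrom-sq≤ n n | isqrtFrom-maximal n n 1 1≤n 1≤n
  ... | suc _ | sq≤n | _ = sq≤n

  <segLen+1-sq : n < suc s * suc s
  <segLen+1-sq with suc (isqrt n) * suc (isqrt n) ≤? n
  ... | no  n≱ = <-≤-trans (≰⇒> n≱) (*-mono-≤ (s≤s isqrt≤segLen) (s≤s isqrt≤segLen))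
  ... | yes ≤n = ⊥-elim (<-irrefl refl (isqrtFrom-maximal n n (suc (isqrt n)) (≤-trans (m≤m*m _) ≤n) ≤n))

pred< : ∀ {m} → 1 ≤ m → pred m < m
pred< {suc m} _ = ≤-refl

<∸⇒+< : ∀ m {n u} → u < n ∸ m → m + u < n
<∸⇒+< zero              u<n = u<n
<∸⇒+< (suc m) {suc n} u<n∸m = s≤s (<∸⇒+< m u<n∸m)

length-concatMap-≤ : ∀ {A : Set} (F : ℕ → List A) (f : ℕ → ℕ) N B →
  (∀ k → k < N → length (F (f k)) ≤ B) → length (concatMap F (applyUpTo f N)) ≤ N * B
length-concatMap-≤ F f zero    B h = z≤n
length-concatMap-≤ F f (suc N) B h = subst (_≤ B + N * B) (sym (length-++ (F (f 0))))
  (+-mono-≤ (h 0 (s≤s z≤n)) (length-concatMap-≤ F (f ∘ suc) N B (λ k k<N → h (suc k) (s≤s k<N))))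

length-map-upTo : ∀ {A : Set} (g : ℕ → A) k → length (map g (upTo k)) ≡ k
length-map-upTo g k = trans (length-map g (upTo k)) (length-upTo k)

square-bound : ∀ c n s L → L ≤ c * (n * s) → (1 ≤ n → s * s ≤ n) → L * L ≤ c * c * (n * n * n)
square-bound c zero    s L L≤ _ =
  subst (λ L → L * L ≤ c * c * 0) (sym (n≤0⇒n≡0 (subst (L ≤_) (*-zeroʳ c) L≤))) z≤n
square-bound c (suc m) s L L≤ s²≤n = begin
    L * L                              ≤⟨ *-mono-≤ L≤ L≤ ⟩
    (c * (n * s)) * (c * (n * s))      ≡⟨ regroup c n s ⟩
    c * c * (n * n * (s * s))          ≤⟨ *-monoʳ-≤ (c * c) (*-monoʳ-≤ (n * n) (s²≤n (s≤s z≤n))) ⟩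
    c * c * (n * n * n)                ∎
  where
  open ≤-Reasoning
  n = suc m
  regroup : ∀ c n s → (c * (n * s)) * (c * (n * s)) ≡ c * c * (n * n * (s * s))
  regroup = solve-∀

module DL (x y : ℤ) (n : ℕ) where

  open Segments (isqrt n ∸ 1) public

  Sh : (ℕ → Offset) → Shape
  Sh = nodes x y n

  onDiagonal inColumns atBottom inLine : ℕ → Offset
  onDiagonal j = (j , j)
  inColumns  j = (base j , j)
  atBottom   j = (base j , j % s)
  inLine     j = (j , 0)

  s′ : ℕ
  s′ = isqrt n ∸ 1

  N : ℕ
  N = numSegs n

  N≡ : N ≡ (n + s′) / s
  N≡ = cong (λ m → (m ∸ 1) / s) (+-suc n s′)

  N*s≤ : N * s ≤ n + s′
  N*s≤ = subst (λ m → m * s ≤ n + s′) (sym N≡) (m/n*n≤m (n + s′) s)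

  segment-nonempty : ∀ {i} → i < N → i * s < n
  segment-nonempty {i} i<N with i * s <? n
  ... | yes i*s<n = i*s<n
  ... | no  i*s≮n = ⊥-elim (<⇒≱ i<N (≤-pred (subst (_< suc i) (sym N≡) (m<n*o⇒m/o<n {o = s} (begin-strict
          n + s′       ≤⟨ +-monoˡ-≤ _ (≮⇒≥ i*s≮n) ⟩
          i * s + s′   <⟨ +-monoʳ-< (i * s) ≤-refl ⟩
          i * s + s               ≡⟨ +-comm (i * s) s ⟩
          suc i * s               ∎)))))
    where open ≤-Reasoning

  segments-cover : n ≤ N * s
  segments-cover = +-cancelˡ-≤ s′ n (N * s) (begin
    s′ + n               ≡⟨ +-comm _ n ⟩
    n + s′               ≡⟨ m≡m%n+[m/n]*n (n + s′) s ⟩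
    (n + s′) % s + ((n + s′) / s) * s ≡⟨ cong (λ m → (n + s′) % s + m * s) (sym N≡) ⟩
    (n + s′) % s + N * s ≤⟨ +-monoˡ-≤ _ (≤-pred (m%n<n (n + s′) s)) ⟩
    s′ + N * s           ∎)
    where open ≤-Reasoning

  row<s : ∀ i {u} → u < segSize n i → u < s
  row<s i u<size = <-≤-trans u<size (m⊓n≤m s _)

  row<n : ∀ i {u} → u < segSize n i → i * s + u < n
  row<n i u<size = <∸⇒+< (i * s) (<-≤-trans u<size (m⊓n≤n s _))

  -- Phase 1. While node k is being moved (after t of its k % s steps), the
  -- nodes j < k are in the columns of their segments, node k is in column
  -- k ∸ t and the nodes j > k have not moved; every node stays in its row.
  phase1-state : ℕ → ℕ → ℕ → Offset
  phase1-state k t j = (select j k (base j) (j ∸ t) j , j)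

  phase1-moves : ℕ → List LineMove
  phase1-moves k = map (λ t → lineMove (at x y (k ∸ t , k)) horizontal 1 backward) (upTo (k % s))

  phase1-step : ∀ k t → k < n → t < k % s →
    applyMove (lineMove (at x y (k ∸ t , k)) horizontal 1 backward) (Sh (phase1-state k t))
      ≡ just (Sh (phase1-state k (suc t)))
  phase1-step k t k<n t<k%s =
    applyMove-node x y horizontal backward (k ∸ t , k) (phase1-state k t) (phase1-state k (suc t)) n k k<n
      (cong (_, k) (select-≡ refl)) 1≤k∸t
      (λ j _ j≢k e → j≢k (cong proj₂ e))
      free
      (cong (_, k) (trans (select-≡ refl) (sym (pred[m∸n]≡m∸[1+n] k t))))
      (λ j j≢k → cong (_, j) (select-≢ (j ∸ t) j≢k))
    where
    1≤k∸t : 1 ≤ k ∸ t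
    1≤k∸t = m<n⇒0<n∸m (<-≤-trans t<k%s (m%n≤m k s))
    -- the only node in row k is node k itself
    free : ∀ j → j < n → phase1-state k t j ≢ (pred (k ∸ t) , k)
    free j _ e with cong proj₂ e
    ... | refl = <-irrefl (trans (sym (cong proj₁ e)) (select-≡ refl)) (pred< 1≤k∸t)

  phase1-next : ∀ k j → phase1-state k (k % s) j ≡ phase1-state (suc k) 0 j
  phase1-next k j = cong (_, j) (select-suc (λ { refl → base-∸ k }) (λ _ → refl))

  phase1-correct : run (phase1 x y n) (Sh onDiagonal) ≡ just (Sh inColumns)
  phase1-correct = begin
    run (phase1 x y n) (Sh onDiagonal)          ≡⟨ cong (run (phase1 x y n)) (nodes-cong x y n initial) ⟩
    run (phase1 x y n) (Sh (phase1-state 0 0))  ≡⟨ run-concatMap phase1-moves id (λ k → Sh (phase1-state k 0)) n node ⟩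
    just (Sh (phase1-state n 0))                ≡⟨ cong just (nodes-cong x y n final) ⟩
    just (Sh inColumns)                         ∎
    where
    open ≡-Reasoning
    initial : ∀ j → j < n → onDiagonal j ≡ phase1-state 0 0 j
    initial j _ = cong (_, j) (sym (select-zero (λ _ → refl)))
    node : ∀ k → k < n → run (phase1-moves k) (Sh (phase1-state k 0)) ≡ just (Sh (phase1-state (suc k) 0))
    node k k<n = trans (run-map _ id (λ t → Sh (phase1-state k t)) (k % s) (λ t t< → phase1-step k t k<n t<))
                       (cong just (nodes-cong x y n (λ j _ → phase1-next k j)))
    final : ∀ j → j < n → phase1-state n 0 j ≡ inColumns j
    final j j<n = cong (_, j) (select-< j<n)

  -- Phase 2. While segment i is being pushed down (after t of its i·s
  -- steps), earlier segments are at the bottom, segment i is t rows below its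
  -- starting position and later segments have not moved; every node stays in
  -- the column of its segment.
  phase2-state : ℕ → ℕ → ℕ → Offset
  phase2-state i t j = (base j , select (j / s) i (j % s) (j ∸ t) j)

  phase2-moves : ℕ → List LineMove
  phase2-moves i = map (λ t → lineMove (at x y (i * s , i * s ∸ t)) vertical (segSize n i) backward) (upTo (i * s))

  phase2-inside : ∀ i t j → j / s ≡ i → phase2-state i t j ≡ (i * s , j ∸ t)
  phase2-inside i t j j/s≡i = cong₂ _,_ (cong (_* s) j/s≡i) (select-≡ j/s≡i)

  phase2-column : ∀ i t j {b} → phase2-state i t j ≡ (i * s , b) → j / s ≡ i
  phase2-column i t j e = base-cancel j i (cong proj₁ e)

  module _ (i t : ℕ) (t<i*s : t < i * s) where

    phase2-occupied : ∀ u → u < segSize n i →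
      ∃ λ j → j < n × phase2-state i t j ≡ along vertical (i * s , i * s ∸ t) u
    phase2-occupied u u<size = i * s + u , row<n i u<size ,
      trans (phase2-inside i t (i * s + u) (/-segment i (row<s i u<size)))
            (cong (i * s ,_) (+-∸-comm u (<⇒≤ t<i*s)))

    -- the target cell lies below the first node of segment i
    phase2-free : ∀ j → j < n → phase2-state i t j ≢ (i * s , pred (i * s ∸ t))
    phase2-free j _ e = <⇒≱ (subst (_< i * s ∸ t) (sym row≡) (pred< 0<i*s∸t)) (∸-monoˡ-≤ t i*s≤j)
      where
      j/s≡i = phase2-column i t j e
      i*s≤j = proj₁ (segment-bounds j i j/s≡i)
      0<i*s∸t = m<n⇒0<n∸m t<i*s
      row≡ : j ∸ t ≡ pred (i * s ∸ t)
      row≡ = cong proj₂ (trans (sym (phase2-inside i t j j/s≡i)) e)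

    phase2-moved : ∀ j → j < n → MovedBy vertical backward (i * s , i * s ∸ t) (segSize n i)
                                          (phase2-state i t) (phase2-state i (suc t)) j
    phase2-moved j j<n with j / s ≟ i
    ... | no  j/s≢i = inj₂ ((λ u _ e → j/s≢i (phase2-column i t j e)) , cong (base j ,_) (select-≢ (j ∸ t) j/s≢i))
    ... | yes j/s≡i = inj₁ ((j ∸ i * s , u<size , trans (phase2-inside i t j j/s≡i) (cong (i * s ,_) row≡)) ,
                            trans (phase2-inside i (suc t) j j/s≡i)
                                  (trans (cong (i * s ,_) (sym (pred[m∸n]≡m∸[1+n] j t)))
                                         (cong (step vertical backward) (sym (phase2-inside i t j j/s≡i)))))
      where
      bounds = segment-bounds j i j/s≡i
      u<size : j ∸ i * s < segSize n i
      u<size = ⊓-glb (subst (j ∸ i * s <_) (m+n∸n≡m s (i * s)) (∸-monoˡ-< (proj₂ bounds) (proj₁ bounds)))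
                     (∸-monoˡ-< j<n (proj₁ bounds))
      row≡ : j ∸ t ≡ i * s ∸ t + (j ∸ i * s)
      row≡ = trans (cong (_∸ t) (sym (m+[n∸m]≡n (proj₁ bounds)))) (+-∸-comm (j ∸ i * s) (<⇒≤ t<i*s))

  phase2-step : ∀ i t → i < N → t < i * s →
    applyMove (lineMove (at x y (i * s , i * s ∸ t)) vertical (segSize n i) backward) (Sh (phase2-state i t))
      ≡ just (Sh (phase2-state i (suc t)))
  phase2-step i t i<N t<i*s =
    applyMove-offsets x y vertical backward (i * s , i * s ∸ t) (segSize n i)
      (phase2-state i t) (phase2-state i (suc t)) n
      (m<n⇒0<n∸m t<i*s) (⊓-glb (s≤s z≤n) (m<n⇒0<n∸m (segment-nonempty i<N)))
      (phase2-occupied i t t<i*s) (phase2-free i t t<i*s) (phase2-moved i t t<i*s)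

  phase2-next : ∀ i j → phase2-state i (i * s) j ≡ phase2-state (suc i) 0 j
  phase2-next i j = cong (base j ,_) (select-suc (λ j/s≡i → trans (cong (λ q → j ∸ q * s) (sym j/s≡i)) (∸-base j))
                                                (λ _ → refl))

  phase2-correct : run (phase2 x y n) (Sh inColumns) ≡ just (Sh atBottom)
  phase2-correct = begin
    run (phase2 x y n) (Sh inColumns)           ≡⟨ cong (run (phase2 x y n)) (nodes-cong x y n initial) ⟩
    run (phase2 x y n) (Sh (phase2-state 0 0))  ≡⟨ run-concatMap phase2-moves id (λ i → Sh (phase2-state i 0)) N segment ⟩
    just (Sh (phase2-state N 0))                ≡⟨ cong just (nodes-cong x y n final) ⟩
    just (Sh atBottom)                          ∎
    where
    open ≡-Reasoning
    initial : ∀ j → j < n → inColumns j ≡ phase2-state 0 0 j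
    initial j _ = cong (base j ,_) (sym (select-zero (λ _ → refl)))
    segment : ∀ i → i < N → run (phase2-moves i) (Sh (phase2-state i 0)) ≡ just (Sh (phase2-state (suc i) 0))
    segment i i<N = trans (run-map _ id (λ t → Sh (phase2-state i t)) (i * s) (λ t t< → phase2-step i t i<N t<))
                          (cong just (nodes-cong x y n (λ j _ → phase2-next i j)))
    final : ∀ j → j < n → phase2-state N 0 j ≡ atBottom j
    final j j<n = cong (base j ,_) (select-< (m<n*o⇒m/o<n (<-≤-trans j<n segments-cover)))

  -- Phase 3. Node K = i·s + r (row r of segment i) walks r cells right and
  -- then r cells down, to (K , 0).  While it does so, the nodes j < K are in
  -- the line, node K is at c and the nodes j > K still wait at the bottom of
  -- their segments.
  phase3-state : ℕ → Offset → ℕ → Offset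
  phase3-state K c j = select j K (j , 0) c (base j , j % s)

  ready : ℕ → ℕ → Offset
  ready K = phase3-state K (base K , K % s)

  rightMoves downMoves rowMoves : ℕ → ℕ → List LineMove
  rightMoves i r = map (λ t → lineMove (at x y (i * s + t , r)) horizontal 1 forward) (upTo r)
  downMoves  i r = map (λ t → lineMove (at x y (i * s + r , r ∸ t)) vertical 1 backward) (upTo r)
  rowMoves   i r = rightMoves i r ++ downMoves i r

  module Row (i r : ℕ) (r<s : r < s) (K<n : i * s + r < n) where

    K : ℕ
    K = i * s + r

    right down : ℕ → ℕ → Offset
    right t = phase3-state K (i * s + t , r)
    down  t = phase3-state K (i * s + r , r ∸ t)

    r≢0 : ∀ {t} → t < r → r ≢ 0
    r≢0 {t} t<r r≡0 = <⇒≱ t<r (subst (_≤ t) (sym r≡0) z≤n)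

    -- A waiting node j > K sits at (base j , j % s).  Bases are multiples of
    -- s (base-aligned), so in the columns of segment i it can only be in
    -- column i·s, and there not in row r, which is node K's place.
    waiting-not-K : ∀ {j} u → K < j → base j ≡ i * s + u → u < s → j % s ≢ r
    waiting-not-K {j} u K<j e u<s j%s≡r = <-irrefl (sym (node-at j i r base≡ j%s≡r)) K<j
      where
      base≡ : base j ≡ i * s
      base≡ = trans e (trans (cong (λ v → i * s + v) (base-aligned j i u e u<s)) (+-identityʳ (i * s)))

    right-step : ∀ t → t < r →
      applyMove (lineMove (at x y (i * s + t , r)) horizontal 1 forward) (Sh (right t)) ≡ just (Sh (right (suc t)))
    right-step t t<r =
      applyMove-node x y horizontal forward (i * s + t , r) (right t) (right (suc t)) n K K<n
        (select-≡ refl) tt distinct free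
        (trans (select-≡ refl) (cong (_, r) (+-suc (i * s) t)))
        (λ j j≢K → select-≢ _ j≢K)
      where
      distinct : ∀ j → j < n → j ≢ K → right t j ≢ (i * s + t , r)
      distinct j _ j≢K e with select-cases j K (j , 0) (i * s + t , r) (base j , j % s)
      ... | inj₁ (_ , eq)             = r≢0 t<r (sym (cong proj₂ (trans (sym eq) e)))
      ... | inj₂ (inj₁ (j≡K , _))     = j≢K j≡K
      ... | inj₂ (inj₂ (K<j , eq))    =
        let e′ = trans (sym eq) e in waiting-not-K t K<j (cong proj₁ e′) (<-trans t<r r<s) (cong proj₂ e′)
      free : ∀ j → j < n → right t j ≢ (suc (i * s + t) , r)
      free j _ e with select-cases j K (j , 0) (i * s + t , r) (base j , j % s)
      ... | inj₁ (_ , eq)             = r≢0 t<r (sym (cong proj₂ (trans (sym eq) e)))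
      ... | inj₂ (inj₁ (_ , eq))      = 1+n≢n (sym (cong proj₁ (trans (sym eq) e)))
      ... | inj₂ (inj₂ (K<j , eq))    = 1+n≢0 (base-aligned j i (suc t)
                                          (trans (cong proj₁ (trans (sym eq) e)) (sym (+-suc (i * s) t)))
                                          (≤-<-trans t<r r<s))

    down-step : ∀ t → t < r →
      applyMove (lineMove (at x y (i * s + r , r ∸ t)) vertical 1 backward) (Sh (down t)) ≡ just (Sh (down (suc t)))
    down-step t t<r =
      applyMove-node x y vertical backward (i * s + r , r ∸ t) (down t) (down (suc t)) n K K<n
        (select-≡ refl) 0<r∸t distinct free
        (trans (select-≡ refl) (cong (i * s + r ,_) (sym (pred[m∸n]≡m∸[1+n] r t))))
        (λ j j≢K → select-≢ _ j≢K)
      where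
      0<r∸t : 1 ≤ r ∸ t
      0<r∸t = m<n⇒0<n∸m t<r
      column-K : ∀ j → j ≢ K → ∀ {b} → down t j ≢ (K , b)
      column-K j j≢K e with select-cases j K (j , 0) (i * s + r , r ∸ t) (base j , j % s)
      ... | inj₁ (j<K , eq)          = <-irrefl (cong proj₁ (trans (sym eq) e)) j<K
      ... | inj₂ (inj₁ (j≡K , _))    = j≢K j≡K
      ... | inj₂ (inj₂ (K<j , eq))   = r≢0 t<r (base-aligned j i r (cong proj₁ (trans (sym eq) e)) r<s)
      distinct : ∀ j → j < n → j ≢ K → down t j ≢ (K , r ∸ t)
      distinct j _ j≢K = column-K j j≢K
      free : ∀ j → j < n → down t j ≢ (K , pred (r ∸ t))
      free j _ e with j ≟ K
      ... | no j≢K  = column-K j j≢K e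
      ... | yes refl = <-irrefl (trans (sym (cong proj₂ e)) (cong proj₂ (select-≡ refl)))
                                (pred< 0<r∸t)

    row-run : run (rowMoves i r) (Sh (ready K)) ≡ just (Sh (ready (suc K)))
    row-run = begin
      run (rowMoves i r) (Sh (ready K))  ≡⟨ cong (run (rowMoves i r)) (nodes-cong x y n ready≡right) ⟩
      run (rowMoves i r) (Sh (right 0))  ≡⟨ run-++ (rightMoves i r) _ _ _ (run-map _ id (Sh ∘ right) r right-step) ⟩
      run (downMoves i r) (Sh (down 0))  ≡⟨ run-map _ id (Sh ∘ down) r down-step ⟩
      just (Sh (down r))                 ≡⟨ cong just (nodes-cong x y n down≡ready) ⟩
      just (Sh (ready (suc K)))          ∎
      where
      open ≡-Reasoning
      ready≡right : ∀ j → j < n → ready K j ≡ right 0 j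
      ready≡right j _ = cong (λ c → phase3-state K c j)
        (cong₂ _,_ (trans (base-segment i r<s) (sym (+-identityʳ (i * s)))) (%-segment i r<s))
      down≡ready : ∀ j → j < n → down r j ≡ ready (suc K) j
      down≡ready j _ = select-suc (λ j≡K → cong₂ _,_ (sym j≡K) (n∸n≡0 r)) (λ { refl → refl })

  segment-run : ∀ i → i < N →
    run (concatMap (rowMoves i) (upTo (segSize n i))) (Sh (ready (i * s))) ≡ just (Sh (ready (suc i * s)))
  segment-run i i<N = begin
    run (concatMap (rowMoves i) (upTo size)) (Sh (ready (i * s)))
      ≡⟨ cong (λ K → run (concatMap (rowMoves i) (upTo size)) (Sh (ready K))) (sym (+-identityʳ (i * s))) ⟩
    run (concatMap (rowMoves i) (upTo size)) (Sh (ready (i * s + 0)))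
      ≡⟨ run-concatMap (rowMoves i) id (λ r → Sh (ready (i * s + r))) size row ⟩
    just (Sh (ready (i * s + size)))
      ≡⟨ cong just (nodes-cong x y n last) ⟩
    just (Sh (ready (suc i * s)))  ∎
    where
    open ≡-Reasoning
    size = segSize n i
    i*s<n = segment-nonempty i<N
    row : ∀ r → r < size → run (rowMoves i r) (Sh (ready (i * s + r))) ≡ just (Sh (ready (i * s + suc r)))
    row r r<size rewrite +-suc (i * s) r = Row.row-run i r (row<s i r<size) (row<n i r<size)
    -- a full segment ends at (i+1)·s; a short last one ends at n
    last : ∀ j → j < n → ready (i * s + size) j ≡ ready (suc i * s) j
    last j j<n with s ≤? n ∸ i * s
    ... | yes s≤ = cong (λ K → ready K j) (trans (cong (λ m → i * s + m) (m≤n⇒m⊓n≡m s≤)) (+-comm (i * s) s))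
    ... | no  s≰ = trans (select-< (subst (j <_) (sym ends-at-n) j<n)) (sym (select-< (<-≤-trans j<n n≤)))
      where
      ends-at-n : i * s + size ≡ n
      ends-at-n = trans (cong (λ m → i * s + m) (m≥n⇒m⊓n≡n (<⇒≤ (≰⇒> s≰)))) (m+[n∸m]≡n (<⇒≤ i*s<n))
      n≤ : n ≤ suc i * s
      n≤ = subst (_≤ s + i * s) ends-at-n (subst (i * s + size ≤_) (+-comm (i * s) s)
                 (+-monoʳ-≤ (i * s) (m⊓n≤m s _)))

  phase3-correct : run (phase3 x y n) (Sh atBottom) ≡ just (Sh inLine)
  phase3-correct = begin
    run (phase3 x y n) (Sh atBottom)   ≡⟨ cong (run (phase3 x y n)) (nodes-cong x y n initial) ⟩
    run (phase3 x y n) (Sh (ready 0))  ≡⟨ run-concatMap _ id (λ i → Sh (ready (i * s))) N segment-run ⟩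
    just (Sh (ready (N * s)))          ≡⟨ cong just (nodes-cong x y n final) ⟩
    just (Sh inLine)                   ∎
    where
    open ≡-Reasoning
    initial : ∀ j → j < n → atBottom j ≡ ready 0 j
    initial j _ = sym (select-zero (λ { refl → refl }))
    final : ∀ j → j < n → ready (N * s) j ≡ inLine j
    final j j<n = select-< (<-≤-trans j<n segments-cover)

  dl-correct : run (dlPartitioning x y n) (diagonal x y n) ≡ just (horizontalLineAt x y n)
  dl-correct = begin
    run (phase1 x y n ++ phase2 x y n ++ phase3 x y n) (diagonal x y n)
      ≡⟨ cong (run (phase1 x y n ++ phase2 x y n ++ phase3 x y n)) (map-upTo _ n) ⟩
    run (phase1 x y n ++ phase2 x y n ++ phase3 x y n) (Sh onDiagonal)
      ≡⟨ run-++ (phase1 x y n) _ _ _ phase1-correct ⟩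
    run (phase2 x y n ++ phase3 x y n) (Sh inColumns)
      ≡⟨ run-++ (phase2 x y n) _ _ _ phase2-correct ⟩
    run (phase3 x y n) (Sh atBottom)
      ≡⟨ phase3-correct ⟩
    just (Sh inLine)
      ≡⟨ cong just line ⟩
    just (horizontalLineAt x y n) ∎
    where
    open ≡-Reasoning
    line : Sh inLine ≡ horizontalLineAt x y n
    line = trans (applyUpTo-cong _ _ n (λ j _ → cong (x ℤ.+ + j ,_) (ℤP.+-identityʳ y))) (sym (map-upTo _ n))

module Lengths (x y : ℤ) (n : ℕ) where

  open DL x y n
  open SegmentLength n using (isqrt≤; isqrt≤segLen; <segLen+1-sq)

  -- node j makes j % s < s moves
  phase1-length : length (phase1 x y n) ≤ n * s
  phase1-length = length-concatMap-≤ phase1-moves id n s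
    (λ j _ → subst (_≤ s) (sym (length-map-upTo _ (j % s))) (m%n≤n j s))

  -- segment i makes i·s < N·s moves
  phase2-length : length (phase2 x y n) ≤ N * (N * s)
  phase2-length = length-concatMap-≤ phase2-moves id N (N * s)
    (λ i i<N → subst (_≤ N * s) (sym (length-map-upTo _ (i * s))) (*-monoˡ-≤ s (<⇒≤ i<N)))

  -- row r of a segment makes 2r < 2s moves
  phase3-length : length (phase3 x y n) ≤ N * (s * (s + s))
  phase3-length = length-concatMap-≤ _ id N (s * (s + s)) λ i _ →
    ≤-trans (length-concatMap-≤ (rowMoves i) id (segSize n i) (s + s) (λ r r<size →
               subst (_≤ s + s) (sym (row-length i r)) (+-mono-≤ (r≤s i r<size) (r≤s i r<size))))
            (*-monoˡ-≤ (s + s) (m⊓n≤m s (n ∸ i * s)))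
    where
    row-length : ∀ i r → length (rowMoves i r) ≡ r + r
    row-length i r = trans (length-++ (rightMoves i r)) (cong₂ _+_ (length-map-upTo _ r) (length-map-upTo _ r))
    r≤s : ∀ i {r} → r < segSize n i → r ≤ s
    r≤s i r<size = <⇒≤ (row<s i r<size)

  -- the segments cover at most n + s′ ≤ 2n nodes
  s′≤s : s′ ≤ s
  s′≤s = ≤-trans (m∸n≤m (isqrt n) 1) isqrt≤segLen

  N*s≤2n : N * s ≤ n + n
  N*s≤2n = ≤-trans N*s≤ (+-monoʳ-≤ n (≤-trans (m∸n≤m (isqrt n) 1) isqrt≤))

  -- there are at most 4s segments, as n < (s + 1)²
  N≤4s : N ≤ 4 * s
  N≤4s = *-cancelʳ-≤ N (4 * s) s (begin
    N * s                  ≤⟨ N*s≤ ⟩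
    n + s′                 ≤⟨ +-mono-≤ (≤-pred <segLen+1-sq) s′≤s ⟩
    s + s * suc s + s      ≡⟨ expand s ⟩
    s * s + 3 * s          ≤⟨ +-monoʳ-≤ (s * s) (*-monoʳ-≤ 3 (m≤m*m s)) ⟩
    s * s + 3 * (s * s)    ≡⟨ collect s ⟩
    4 * s * s              ∎)
    where
    open ≤-Reasoning
    expand : ∀ s → s + s * suc s + s ≡ s * s + 3 * s
    expand = solve-∀
    collect : ∀ s → s * s + 3 * (s * s) ≡ 4 * s * s
    collect = solve-∀

  -- in total at most n·s + 4s·2n + 2n·2s = 13·n·s moves
  dl-length : length (dlPartitioning x y n) ≤ 13 * (n * s)
  dl-length = begin
    length (phase1 x y n ++ phase2 x y n ++ phase3 x y n)
      ≡⟨ trans (length-++ (phase1 x y n)) (cong (λ m → length (phase1 x y n) + m) (length-++ (phase2 x y n))) ⟩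
    length (phase1 x y n) + (length (phase2 x y n) + length (phase3 x y n))
      ≤⟨ +-mono-≤ phase1-length (+-mono-≤ phase2-length phase3-length) ⟩
    n * s + (N * (N * s) + N * (s * (s + s)))
      ≡⟨ cong (λ m → n * s + (N * (N * s) + m)) (sym (*-assoc N s (s + s))) ⟩
    n * s + (N * (N * s) + (N * s) * (s + s))
      ≤⟨ +-monoʳ-≤ (n * s) (+-mono-≤ (*-mono-≤ N≤4s N*s≤2n) (*-monoˡ-≤ (s + s) N*s≤2n)) ⟩
    n * s + ((4 * s) * (n + n) + (n + n) * (s + s))
      ≡⟨ collect n s ⟩
    13 * (n * s) ∎
    where
    open ≤-Reasoning
    collect : ∀ n s → n * s + ((4 * s) * (n + n) + (n + n) * (s + s)) ≡ 13 * (n * s)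
    collect = solve-∀

theorem3p1 : ∃ λ (C : ℕ) → ∀ (x y : ℤ) (n : ℕ) →
    ∃ λ S → run (dlPartitioning x y n) (diagonal x y n) ≡ just S
    × IsHorizontalLine S n
    × length (dlPartitioning x y n) * length (dlPartitioning x y n) ≤ C * C * (n * n * n)
theorem3p1 = 13 , λ x y n →
    horizontalLineAt x y n
  , DL.dl-correct x y n
  , (x , y , λ c → mk⇔ id id)
  , square-bound 13 n (segLen n) _ (Lengths.dl-length x y n) (SegmentLength.segLen-sq≤ n)
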